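{- For all incidence hypergraphs $G,H$ there are isomorphisms $[G,H]_{L}^{\#}\cong[G,H^{\#}]_{L}\cong[G^{\#},H]_{L}$, natural in $G$ and $H$.
   Context: An incidence hypergraph $G$ consists of sets $\check V(G)$, $\check E(G)$, $I(G)$ and functions $\varsigma_G:I(G)\to\check V(G)$, $\omega_G:I(G)\to\check E(G)$; a homomorphism is a triple of functions commuting with $\varsigma,\omega$; $\mathfrak R(G,H)$ is the set of homomorphisms. Incidence dual: $G^\#:=(\check E(G),\check V(G),I(G),\omega_G,\varsigma_G)$, $\phi^\#=(\check E\phi,\check V\phi,I\phi)$. Laplacian product: $\check V(G\blacksquare H)=(\{1\}\times\check V(G)\times\check V(H))\cup(\{4\}\times\check E(G)\times\check E(H))$, $\check E(G\blacksquare H)=(\{2\}\times\check E(G)\times\check V(H))\cup(\{3\}\times\check V(G)\times\check E(H))$, $I(G\blacksquare H)=(\{1\}\times I(G)\times\check V(H))\cup(\{2\}\times I(G)\times\check E(H))\cup(\{3\}\times\check E(G)\times I(H))\cup(\{4\}\times\check V(G)\times I(H))$, with $\varsigma(1,x,y)=(1,\varsigma_G(x),y)$, $\varsigma(2,x,y)=(4,\omega_G(x),y)$, $\varsigma(3,x,y)=(4,x,\omega_H(y))$, $\varsigma(4,x,y)=(1,x,\varsigma_H(y))$, $\omega(1,x,y)=(2,\omega_G(x),y)$, $\omega(2,x,y)=(3,\varsigma_G(x),y)$, $\omega(3,x,y)=(2,x,\varsigma_H(y))$, $\omega(4,x,y)=(3,x,\omega_H(y))$; on morphisms componentwise. $\check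 V^\diamond(\{1\})$: one vertex, nothing else; $\check E^\diamond(\{1\})$: one edge, nothing else; $I^\diamond(\{1\})$: one vertex $1$, one edge $1$, one incidence joining them. $Y(y),Y(z)$ are the inclusions of $\check V^\diamond(\{1\})$ and $\check E^\diamond(\{1\})$ into $I^\diamond(\{1\})$. $\check\rho_G:G\blacksquare\check V^\diamond(\{1\})\to G$ is $(1,v,1)\mapsto v,(2,e,1)\mapsto e,(1,i,1)\mapsto i$; $\hat\rho_G:G\blacksquare\check E^\diamond(\{1\})\to G^\#$ is $(4,e,1)\mapsto e,(3,v,1)\mapsto v,(2,i,1)\mapsto i$. Laplacian exponential $[G,H]_L$: vertices $\mathfrak R(G,H)$, edges $\mathfrak R(G^\#,H)$, incidences $\mathfrak R(G\blacksquare I^\diamond(\{1\}),H)$, $\varsigma(\psi)=\psi\circ(G\blacksquare Y(y))\circ\check\rho_G^{ -1}$, $\omega(\psi)=\psi\circ(G\blacksquare Y(z))\circ\hat\rho_G^{ -1}$. (It is the right adjoint to $G\blacksquare(-)$: $\mathfrak R(G\blacksquare K,H)\cong\mathfrak R(K,[G,H]_L)$ naturally.) -}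

module Defs where

open import Data.Unit using (⊤; tt)
open import Data.Empty using (⊥; ⊥-elim)
open import Data.Product using (_×_)
open import Level using (0ℓ)
open import Function using (id; _∘_)
open import Relation.Binary.PropositionalEquality
  using (_≡_; refl; sym; trans; cong; cong₂; _≗_)
open import Axiom.Extensionality.Propositional using (Extensionality)
open import Axiom.UniquenessOfIdentityProofs.WithK using (uip)

record IHG : Set₁ where
  constructor mkIHG
  field
    V : Set
    E : Set
    I : Set
    ς : I → V
    ω : I → E
open IHG public

record Hom (G H : IHG) : Set where
  constructor mkHom
  field
    fV : V G → V H
    fE : E G → E H
    fI : I G → I H
    ςc : ∀ i → ς H (fI i) ≡ fV (ς G i)
    ωc : ∀ i → ω H (fI i) ≡ fE (ω G i)
open Hom public

idH : (G : IHG) → Hom G G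
idH G = mkHom id id id (λ _ → refl) (λ _ → refl)

infixr 9 _∘H_
_∘H_ : {G H K : IHG} → Hom H K → Hom G H → Hom G K
ψ ∘H φ = mkHom (fV ψ ∘ fV φ) (fE ψ ∘ fE φ) (fI ψ ∘ fI φ)
  (λ i → trans (ςc ψ (fI φ i)) (cong (fV ψ) (ςc φ i)))
  (λ i → trans (ωc ψ (fI φ i)) (cong (fE ψ) (ωc φ i)))

infix 4 _≈H_
_≈H_ : {G H : IHG} → Hom G H → Hom G H → Set
φ ≈H ψ = (fV φ ≗ fV ψ) × (fE φ ≗ fE ψ) × (fI φ ≗ fI ψ)

record Iso (G H : IHG) : Set where
  field
    to      : Hom G H
    from    : Hom H G
    from∘to : from ∘H to ≈H idH G
    to∘from : to ∘H from ≈H idH H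
open Iso public

homEq : Extensionality 0ℓ 0ℓ → {G H : IHG} {φ ψ : Hom G H} →
        fV φ ≗ fV ψ → fE φ ≗ fE ψ → fI φ ≗ fI ψ → φ ≡ ψ
homEq ext {φ = mkHom a b c d e} {ψ = mkHom a' b' c' d' e'} p q r
  with ext p | ext q | ext r
... | refl | refl | refl =
  cong₂ (mkHom a b c) (ext (λ i → uip _ _)) (ext (λ i → uip _ _))

infix 10 _#
_# : IHG → IHG
G # = mkIHG (E G) (V G) (I G) (ω G) (ς G)

infix 10 _#H
_#H : {G H : IHG} → Hom G H → Hom (G #) (H #)
φ #H = mkHom (fE φ) (fV φ) (fI φ) (ωc φ) (ςc φ)

module _ (G H : IHG) where
  data PV : Set where
    v1 : V G → V H → PV
    v4 : E G → E H → PV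

  data PE : Set where
    e2 : E G → V H → PE
    e3 : V G → E H → PE

  data PI : Set where
    i1 : I G → V H → PI
    i2 : I G → E H → PI
    i3 : E G → I H → PI
    i4 : V G → I H → PI

  Pς : PI → PV
  Pς (i1 x y) = v1 (ς G x) y
  Pς (i2 x y) = v4 (ω G x) y
  Pς (i3 x y) = v4 x (ω H y)
  Pς (i4 x y) = v1 x (ς H y)

  Pω : PI → PE
  Pω (i1 x y) = e2 (ω G x) y
  Pω (i2 x y) = e3 (ς G x) y
  Pω (i3 x y) = e2 x (ς H y)
  Pω (i4 x y) = e3 x (ω H y)

infixl 7 _■_
_■_ : IHG → IHG → IHG
G ■ H = mkIHG (PV G H) (PE G H) (PI G H) (Pς G H) (Pω G H)

infixl 7 _■H_
_■H_ : {G G' H H' : IHG} → Hom G G' → Hom H H' → Hom (G ■ H) (G' ■ H')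
_■H_ {G} {G'} {H} {H'} φ ψ = mkHom mV mE mI mς mω
  where
  mV : PV G H → PV G' H'
  mV (v1 x y) = v1 (fV φ x) (fV ψ y)
  mV (v4 x y) = v4 (fE φ x) (fE ψ y)
  mE : PE G H → PE G' H'
  mE (e2 x y) = e2 (fE φ x) (fV ψ y)
  mE (e3 x y) = e3 (fV φ x) (fE ψ y)
  mI : PI G H → PI G' H'
  mI (i1 x y) = i1 (fI φ x) (fV ψ y)
  mI (i2 x y) = i2 (fI φ x) (fE ψ y)
  mI (i3 x y) = i3 (fE φ x) (fI ψ y)
  mI (i4 x y) = i4 (fV φ x) (fI ψ y)
  mς : ∀ i → Pς G' H' (mI i) ≡ mV (Pς G H i)
  mς (i1 x y) = cong (λ a → v1 a (fV ψ y)) (ςc φ x)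
  mς (i2 x y) = cong (λ a → v4 a (fE ψ y)) (ωc φ x)
  mς (i3 x y) = cong (v4 (fE φ x)) (ωc ψ y)
  mς (i4 x y) = cong (v1 (fV φ x)) (ςc ψ y)
  mω : ∀ i → Pω G' H' (mI i) ≡ mE (Pω G H i)
  mω (i1 x y) = cong (λ a → e2 a (fV ψ y)) (ωc φ x)
  mω (i2 x y) = cong (λ a → e3 a (fE ψ y)) (ςc φ x)
  mω (i3 x y) = cong (e2 (fE φ x)) (ςc ψ y)
  mω (i4 x y) = cong (e3 (fV φ x)) (ωc ψ y)

Vdia : IHG
Vdia = mkIHG ⊤ ⊥ ⊥ ⊥-elim ⊥-elim

Edia : IHG
Edia = mkIHG ⊥ ⊤ ⊥ ⊥-elim ⊥-elim

Idia : IHG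
Idia = mkIHG ⊤ ⊤ ⊤ (λ _ → tt) (λ _ → tt)

Yy : Hom Vdia Idia
Yy = mkHom (λ _ → tt) ⊥-elim ⊥-elim (λ ()) (λ ())

Yz : Hom Edia Idia
Yz = mkHom ⊥-elim (λ _ → tt) ⊥-elim (λ ()) (λ ())

ρ̌ : (G : IHG) → Hom (G ■ Vdia) G
ρ̌ G = mkHom rV rE rI rς rω
  where
  rV : PV G Vdia → V G
  rV (v1 v _) = v
  rV (v4 _ ())
  rE : PE G Vdia → E G
  rE (e2 e _) = e
  rE (e3 _ ())
  rI : PI G Vdia → I G
  rI (i1 i _) = i
  rI (i2 _ ())
  rI (i3 _ ())
  rI (i4 _ ())
  rς : ∀ i → ς G (rI i) ≡ rV (Pς G Vdia i)
  rς (i1 i _) = refl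
  rς (i2 _ ())
  rς (i3 _ ())
  rς (i4 _ ())
  rω : ∀ i → ω G (rI i) ≡ rE (Pω G Vdia i)
  rω (i1 i _) = refl
  rω (i2 _ ())
  rω (i3 _ ())
  rω (i4 _ ())

ρ̌⁻¹ : (G : IHG) → Hom G (G ■ Vdia)
ρ̌⁻¹ G = mkHom (λ v → v1 v tt) (λ e → e2 e tt) (λ i → i1 i tt)
  (λ _ → refl) (λ _ → refl)

ρ̂ : (G : IHG) → Hom (G ■ Edia) (G #)
ρ̂ G = mkHom rV rE rI rς rω
  where
  rV : PV G Edia → E G
  rV (v1 _ ())
  rV (v4 e _) = e
  rE : PE G Edia → V G
  rE (e2 _ ())
  rE (e3 v _) = v
  rI : PI G Edia → I G
  rI (i1 _ ())
  rI (i2 i _) = i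
  rI (i3 _ ())
  rI (i4 _ ())
  rς : ∀ i → ω G (rI i) ≡ rV (Pς G Edia i)
  rς (i1 _ ())
  rς (i2 i _) = refl
  rς (i3 _ ())
  rς (i4 _ ())
  rω : ∀ i → ς G (rI i) ≡ rE (Pω G Edia i)
  rω (i1 _ ())
  rω (i2 i _) = refl
  rω (i3 _ ())
  rω (i4 _ ())

ρ̂⁻¹ : (G : IHG) → Hom (G #) (G ■ Edia)
ρ̂⁻¹ G = mkHom (λ e → v4 e tt) (λ v → e3 v tt) (λ i → i2 i tt)
  (λ _ → refl) (λ _ → refl)

expL : IHG → IHG → IHG
expL G H = mkIHG (Hom G H) (Hom (G #) H) (Hom (G ■ Idia) H)
  (λ ψ → ψ ∘H (idH G ■H Yy) ∘H ρ̌⁻¹ G)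
  (λ ψ → ψ ∘H (idH G ■H Yz) ∘H ρ̂⁻¹ G)

expLH : Extensionality 0ℓ 0ℓ → {G G' H H' : IHG} →
        Hom G G' → Hom H H' → Hom (expL G' H) (expL G H')
expLH ext φ ψ = mkHom
  (λ χ → ψ ∘H χ ∘H φ)
  (λ χ → ψ ∘H χ ∘H (φ #H))
  (λ χ → ψ ∘H χ ∘H (φ ■H idH Idia))
  (λ χ → homEq ext (λ _ → refl) (λ _ → refl) (λ _ → refl))
  (λ χ → homEq ext (λ _ → refl) (λ _ → refl) (λ _ → refl))

module Submission where

open import Defs
open import Level using (0ℓ)
open import Data.Product using (Σ; _×_; _,_)
open import Function using (_∘_)
open import Relation.Binary.PropositionalEquality using (_≡_; refl; cong)
open import Axiom.Extensionality.Propositional using (Extensionality)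

-- The dual of a Laplacian product can be moved onto either factor:
-- (G ■ H)# ≅ G# ■ H ≅ G ■ H#, naturally in G and H, by maps that only relabel
-- the four summands. Since Idia # is Idia, precomposing with these maps sends
-- incidences G ■ Idia → H of [G,H]_L to incidences G ■ Idia → H# of [G,H#]_L,
-- and those to incidences G# ■ Idia → H of [G#,H]_L, while on vertices and
-- edges duality of homs Hom G H ≅ Hom (G #) (H #) does the job.

■-dualˡ : (G H : IHG) → Hom (G ■ H) ((G # ■ H) #)
■-dualˡ G H = mkHom dV dE dI dς dω
  where
  dV : PV G H → PE (G #) H
  dV (v1 v w) = e2 v w
  dV (v4 e f) = e3 e f
  dE : PE G H → PV (G #) H
  dE (e2 e w) = v1 e w
  dE (e3 v f) = v4 v f
  dI : PI G H → PI (G #) H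
  dI (i1 i w) = i1 i w
  dI (i2 i f) = i2 i f
  dI (i3 e j) = i4 e j
  dI (i4 v j) = i3 v j
  dς : ∀ i → Pω (G #) H (dI i) ≡ dV (Pς G H i)
  dς (i1 _ _) = refl
  dς (i2 _ _) = refl
  dς (i3 _ _) = refl
  dς (i4 _ _) = refl
  dω : ∀ i → Pς (G #) H (dI i) ≡ dE (Pω G H i)
  dω (i1 _ _) = refl
  dω (i2 _ _) = refl
  dω (i3 _ _) = refl
  dω (i4 _ _) = refl

■-dualʳ : (G H : IHG) → Hom (G ■ H) ((G ■ H #) #)
■-dualʳ G H = mkHom dV dE dI dς dω
  where
  dV : PV G H → PE G (H #)
  dV (v1 v w) = e3 v w
  dV (v4 e f) = e2 e f
  dE : PE G H → PV G (H #)
  dE (e2 e w) = v4 e w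
  dE (e3 v f) = v1 v f
  dI : PI G H → PI G (H #)
  dI (i1 i w) = i2 i w
  dI (i2 i f) = i1 i f
  dI (i3 e j) = i3 e j
  dI (i4 v j) = i4 v j
  dς : ∀ i → Pω G (H #) (dI i) ≡ dV (Pς G H i)
  dς (i1 _ _) = refl
  dς (i2 _ _) = refl
  dς (i3 _ _) = refl
  dς (i4 _ _) = refl
  dω : ∀ i → Pς G (H #) (dI i) ≡ dE (Pω G H i)
  dω (i1 _ _) = refl
  dω (i2 _ _) = refl
  dω (i3 _ _) = refl
  dω (i4 _ _) = refl

■-dualˡ-involutive : (G H : IHG) → (■-dualˡ (G #) H) #H ∘H ■-dualˡ G H ≈H idH (G ■ H)
■-dualˡ-involutive G H = dV , dE , dI
  where
  dV : ∀ x → fE (■-dualˡ (G #) H) (fV (■-dualˡ G H) x) ≡ x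
  dV (v1 _ _) = refl
  dV (v4 _ _) = refl
  dE : ∀ x → fV (■-dualˡ (G #) H) (fE (■-dualˡ G H) x) ≡ x
  dE (e2 _ _) = refl
  dE (e3 _ _) = refl
  dI : ∀ x → fI (■-dualˡ (G #) H) (fI (■-dualˡ G H) x) ≡ x
  dI (i1 _ _) = refl
  dI (i2 _ _) = refl
  dI (i3 _ _) = refl
  dI (i4 _ _) = refl

■-dualʳ-involutive : (G H : IHG) → (■-dualʳ G (H #)) #H ∘H ■-dualʳ G H ≈H idH (G ■ H)
■-dualʳ-involutive G H = dV , dE , dI
  where
  dV : ∀ x → fE (■-dualʳ G (H #)) (fV (■-dualʳ G H) x) ≡ x
  dV (v1 _ _) = refl
  dV (v4 _ _) = refl
  dE : ∀ x → fV (■-dualʳ G (H #)) (fE (■-dualʳ G H) x) ≡ x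
  dE (e2 _ _) = refl
  dE (e3 _ _) = refl
  dI : ∀ x → fI (■-dualʳ G (H #)) (fI (■-dualʳ G H) x) ≡ x
  dI (i1 _ _) = refl
  dI (i2 _ _) = refl
  dI (i3 _ _) = refl
  dI (i4 _ _) = refl

■-dualˡ-natural : {G G' H H' : IHG} (φ : Hom G G') (ψ : Hom H H') →
  ■-dualˡ G' H' ∘H (φ ■H ψ) ≈H (φ #H ■H ψ) #H ∘H ■-dualˡ G H
■-dualˡ-natural φ ψ = dV , dE , dI
  where
  dV : ∀ x → fV (■-dualˡ _ _ ∘H (φ ■H ψ)) x ≡ fV ((φ #H ■H ψ) #H ∘H ■-dualˡ _ _) x
  dV (v1 _ _) = refl
  dV (v4 _ _) = refl
  dE : ∀ x → fE (■-dualˡ _ _ ∘H (φ ■H ψ)) x ≡ fE ((φ #H ■H ψ) #H ∘H ■-dualˡ _ _) x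
  dE (e2 _ _) = refl
  dE (e3 _ _) = refl
  dI : ∀ x → fI (■-dualˡ _ _ ∘H (φ ■H ψ)) x ≡ fI ((φ #H ■H ψ) #H ∘H ■-dualˡ _ _) x
  dI (i1 _ _) = refl
  dI (i2 _ _) = refl
  dI (i3 _ _) = refl
  dI (i4 _ _) = refl

■-dualʳ-natural : {G G' H H' : IHG} (φ : Hom G G') (ψ : Hom H H') →
  ■-dualʳ G' H' ∘H (φ ■H ψ) ≈H (φ ■H ψ #H) #H ∘H ■-dualʳ G H
■-dualʳ-natural φ ψ = dV , dE , dI
  where
  dV : ∀ x → fV (■-dualʳ _ _ ∘H (φ ■H ψ)) x ≡ fV ((φ ■H ψ #H) #H ∘H ■-dualʳ _ _) x
  dV (v1 _ _) = refl
  dV (v4 _ _) = refl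
  dE : ∀ x → fE (■-dualʳ _ _ ∘H (φ ■H ψ)) x ≡ fE ((φ ■H ψ #H) #H ∘H ■-dualʳ _ _) x
  dE (e2 _ _) = refl
  dE (e3 _ _) = refl
  dI : ∀ x → fI (■-dualʳ _ _ ∘H (φ ■H ψ)) x ≡ fI ((φ ■H ψ #H) #H ∘H ■-dualʳ _ _) x
  dI (i1 _ _) = refl
  dI (i2 _ _) = refl
  dI (i3 _ _) = refl
  dI (i4 _ _) = refl

-- φ and ψ are explicit: _≈H_ unfolds to componentwise equations, from which
-- Agda cannot reconstruct the homomorphisms.
∘H-congˡ : {G H K : IHG} (χ : Hom H K) (φ ψ : Hom G H) → φ ≈H ψ → χ ∘H φ ≈H χ ∘H ψ
∘H-congˡ χ _ _ (p , q , r) = cong (fV χ) ∘ p , cong (fE χ) ∘ q , cong (fI χ) ∘ r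

module _ (ext : Extensionality 0ℓ 0ℓ) where

  ≈H⇒≡ : {G H : IHG} {φ ψ : Hom G H} → φ ≈H ψ → φ ≡ ψ
  ≈H⇒≡ (p , q , r) = homEq ext p q r

  dual-expL⇒expL-dualʳ : (G H : IHG) → Hom ((expL G H) #) (expL G (H #))
  dual-expL⇒expL-dualʳ G H = mkHom _#H _#H (λ ψ → ψ #H ∘H ■-dualʳ G Idia)
    (λ _ → homEq ext (λ _ → refl) (λ _ → refl) (λ _ → refl))
    (λ _ → homEq ext (λ _ → refl) (λ _ → refl) (λ _ → refl))

  dual-expL≅expL-dualʳ : (G H : IHG) → Iso ((expL G H) #) (expL G (H #))
  dual-expL≅expL-dualʳ G H = record
    { to      = dual-expL⇒expL-dualʳ G H
    ; from    = (dual-expL⇒expL-dualʳ G (H #)) #H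
    ; from∘to = (λ _ → refl) , (λ _ → refl) , cancel
    ; to∘from = (λ _ → refl) , (λ _ → refl) , cancel
    }
    where
    cancel : {K : IHG} (ψ : Hom (G ■ Idia) K) → (ψ #H ∘H ■-dualʳ G Idia) #H ∘H ■-dualʳ G Idia ≡ ψ
    cancel ψ = ≈H⇒≡ (∘H-congˡ ψ (■-dualʳ G Idia #H ∘H ■-dualʳ G Idia) (idH _)
                                (■-dualʳ-involutive G Idia))

  expL-dualʳ⇒expL-dualˡ : (G H : IHG) → Hom (expL G (H #)) (expL (G #) H)
  expL-dualʳ⇒expL-dualˡ G H = mkHom _#H _#H (λ ψ → ψ #H ∘H ■-dualˡ (G #) Idia)
    (λ _ → homEq ext (λ _ → refl) (λ _ → refl) (λ _ → refl))
    (λ _ → homEq ext (λ _ → refl) (λ _ → refl) (λ _ → refl))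

  expL-dualˡ⇒expL-dualʳ : (G H : IHG) → Hom (expL (G #) H) (expL G (H #))
  expL-dualˡ⇒expL-dualʳ G H = mkHom _#H _#H (λ ψ → ψ #H ∘H ■-dualˡ G Idia)
    (λ _ → homEq ext (λ _ → refl) (λ _ → refl) (λ _ → refl))
    (λ _ → homEq ext (λ _ → refl) (λ _ → refl) (λ _ → refl))

  expL-dualʳ≅expL-dualˡ : (G H : IHG) → Iso (expL G (H #)) (expL (G #) H)
  expL-dualʳ≅expL-dualˡ G H = record
    { to      = expL-dualʳ⇒expL-dualˡ G H
    ; from    = expL-dualˡ⇒expL-dualʳ G H
    ; from∘to = (λ _ → refl) , (λ _ → refl) ,
                (λ ψ → ≈H⇒≡ (∘H-congˡ ψ (■-dualˡ (G #) Idia #H ∘H ■-dualˡ G Idia) (idH _)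
                                         (■-dualˡ-involutive G Idia)))
    ; to∘from = (λ _ → refl) , (λ _ → refl) ,
                (λ ψ → ≈H⇒≡ (∘H-congˡ ψ (■-dualˡ G Idia #H ∘H ■-dualˡ (G #) Idia) (idH _)
                                         (■-dualˡ-involutive (G #) Idia)))
    }

  dual-expL≅expL-dualʳ-natural : {G G' H H' : IHG} (φ : Hom G G') (ψ : Hom H H') →
    expLH ext φ (ψ #H) ∘H to (dual-expL≅expL-dualʳ G' H)
      ≈H to (dual-expL≅expL-dualʳ G H') ∘H (expLH ext φ ψ) #H
  dual-expL≅expL-dualʳ-natural φ ψ = (λ _ → refl) , (λ _ → refl) ,
    (λ χ → ≈H⇒≡ (∘H-congˡ (ψ #H ∘H χ #H)
      (■-dualʳ _ Idia ∘H (φ ■H idH Idia)) ((φ ■H idH Idia) #H ∘H ■-dualʳ _ Idia)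
      (■-dualʳ-natural φ (idH Idia))))

  expL-dualʳ≅expL-dualˡ-natural : {G G' H H' : IHG} (φ : Hom G G') (ψ : Hom H H') →
    expLH ext (φ #H) ψ ∘H to (expL-dualʳ≅expL-dualˡ G' H)
      ≈H to (expL-dualʳ≅expL-dualˡ G H') ∘H expLH ext φ (ψ #H)
  expL-dualʳ≅expL-dualˡ-natural φ ψ = (λ _ → refl) , (λ _ → refl) ,
    (λ χ → ≈H⇒≡ (∘H-congˡ (ψ ∘H χ #H)
      (■-dualˡ _ Idia ∘H (φ #H ■H idH Idia)) ((φ ■H idH Idia) #H ∘H ■-dualˡ _ Idia)
      (■-dualˡ-natural (φ #H) (idH Idia))))

mainTheorem4 : (ext : Extensionality 0ℓ 0ℓ) →
    Σ ((G H : IHG) → Iso ((expL G H) #) (expL G (H #))) (λ α →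
      ({G G' H H' : IHG} (φ : Hom G G') (ψ : Hom H H') →
        expLH ext φ (ψ #H) ∘H to (α G' H) ≈H to (α G H') ∘H (expLH ext φ ψ) #H))
    ×
    Σ ((G H : IHG) → Iso (expL G (H #)) (expL (G #) H)) (λ β →
      ({G G' H H' : IHG} (φ : Hom G G') (ψ : Hom H H') →
        expLH ext (φ #H) ψ ∘H to (β G' H) ≈H to (β G H') ∘H expLH ext φ (ψ #H)))
mainTheorem4 ext =
  (dual-expL≅expL-dualʳ ext , dual-expL≅expL-dualʳ-natural ext) ,
  (expL-dualʳ≅expL-dualˡ ext , expL-dualʳ≅expL-dualˡ-natural ext)
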